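{- Let $Q$ be a quadratic form on $\mathbb{F}_2^n$ with bilinear form $B(u,v)=Q(u+v)+Q(u)+Q(v)$. Let $H\subseteq\mathbb{F}_2^n$ be a subspace of codimension $1$, let $S=\{v\in\mathbb{F}_2^n:Q(v)=0\}\setminus H$, and suppose $S$ generates $\mathbb{F}_2^n$. Then for every subset $T\subseteq S$ with $T\cap\{r\in\mathrm{rad}(\mathbb{F}_2^n):Q(r)=0\}=\varnothing$, \[|T^{\perp}\cap T|\le|S|-|T|.\]
   Context: $\mathrm{rad}(\mathbb{F}_2^n)=\{r: B(r,w)=0\text{ for all }w\}$. For $T\subseteq\mathbb{F}_2^n$, $T^{\perp}=\{v:B(v,t)=0\text{ for all }t\in T\}$. A quadratic form on $\mathbb{F}_2^n$ is a map $Q(u)=\sum_{i\le j}a_{ij}u_iu_j$. -}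

module Defs where

open import Data.Bool using (Bool; true; false; _xor_; _∧_; _∨_; not; if_then_else_)
open import Data.Nat using (ℕ; zero; suc; _≤ᵇ_)
open import Data.Fin using (Fin; toℕ)
open import Data.List using (List; []; _∷_; _++_; map; concatMap; foldr; length; filterᵇ; allFin)
open import Data.List.Relation.Unary.All using (All)
open import Data.Vec using (Vec; []; _∷_; zipWith; replicate; lookup; toList)
open import Data.Product using (∃; _×_)
open import Relation.Binary.PropositionalEquality using (_≡_)

-- vectors of F_2^n  (false = 0, true = 1)
F2 : ℕ → Set
F2 n = Vec Bool n

_⊕_ : ∀ {n} → F2 n → F2 n → F2 n
_⊕_ = zipWith _xor_

0v : ∀ {n} → F2 n
0v = replicate _ false

allVecs : (n : ℕ) → List (F2 n)
allVecs zero = [] ∷ []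
allVecs (suc n) = map (true ∷_) (allVecs n) ++ map (false ∷_) (allVecs n)

xorSum : List Bool → Bool
xorSum = foldr _xor_ false

-- coefficients a_ij of a quadratic form (only i ≤ j are used)
Coeffs : ℕ → Set
Coeffs n = Fin n → Fin n → Bool

evalQ : ∀ {n} → Coeffs n → F2 n → Bool
evalQ {n} a u = xorSum (concatMap (λ i → map (λ j →
  if toℕ i ≤ᵇ toℕ j then a i j ∧ (lookup u i ∧ lookup u j) else false)
  (allFin n)) (allFin n))

bilin : ∀ {n} → Coeffs n → F2 n → F2 n → Bool
bilin a u v = evalQ a (u ⊕ v) xor (evalQ a u xor evalQ a v)

-- subsets of F_2^n as Boolean predicates (every subset of a finite set is decidable)
Subset : ℕ → Set
Subset n = F2 n → Bool

_∈_ : ∀ {n} → F2 n → Subset n → Set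
v ∈ P = P v ≡ true

card : ∀ {n} → Subset n → ℕ
card {n} P = length (filterᵇ P (allVecs n))

IsSubspace : ∀ {n} → Subset n → Set
IsSubspace {n} H = (0v ∈ H) × (∀ (u v : F2 n) → u ∈ H → v ∈ H → (u ⊕ v) ∈ H)

Sset : ∀ {n} → Coeffs n → Subset n → Subset n
Sset a H v = not (evalQ a v) ∧ not (H v)

Generates : ∀ {n} → Subset n → Set
Generates {n} S = ∀ (v : F2 n) → ∃ λ (ls : List (F2 n)) → All (λ s → s ∈ S) ls × foldr _⊕_ 0v ls ≡ v

InRad : ∀ {n} → Coeffs n → F2 n → Set
InRad {n} a r = ∀ (w : F2 n) → bilin a r w ≡ false

allB : ∀ {A : Set} → (A → Bool) → List A → Bool
allB p = foldr (λ x b → p x ∧ b) true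

perp : ∀ {n} → Coeffs n → Subset n → Subset n
perp {n} a T v = allB (λ t → not (T t) ∨ not (bilin a v t)) (allVecs n)

_∩_ : ∀ {n} → Subset n → Subset n → Subset n
(P ∩ R) v = P v ∧ R v

module Submission where

-- Let S = {Q = 0} \ H and U = T^⊥ ∩ T.  The theorem follows from the
-- counting inequality  |U| ≤ |{s ∈ S : B(s,u) = 1 for some u ∈ U}|,
-- since no element of T pairs nontrivially with an element of T^⊥, so the
-- right-hand side is at most |S \ T| = |S| - |T|.
--
-- The counting inequality holds for every duplicate-free list U ⊆ S that is
-- totally isotropic and whose elements each pair nontrivially with some
-- σ ∈ S (an "admissible" list).  It is proved by induction on |U|: fix u₀ ∈ U
-- and σ ∈ S with B(σ,u₀) = 1, split U into U₁ = {B(σ,-) = 1} and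
-- U₀ = {B(σ,-) = 0}; by induction U₀ has at least |U₀| partners, and the
-- translation u ↦ σ + u₀ + u maps U₁ injectively to partners of U that are
-- not partners of U₀.  This uses that H has index two (so u₀ + u ∈ H) and
-- that B is bilinear with Q(x + y) = B(x,y) + Q(x) + Q(y).

open import Defs
open import Algebra.Bundles using (CommutativeRing)
open import Data.Bool using (Bool; true; false; _xor_; _∧_; _∨_; not; if_then_else_; T; T?)
open import Data.Bool.Properties
  using (xor-assoc; xor-comm; xor-same; xor-identityˡ; xor-identityʳ; ∧-distribˡ-xor; ∧-distribʳ-xor;
         ∧-zeroʳ; ¬-not; T-≡; xor-∧-commutativeRing; _≟_)
open import Algebra.Properties.CommutativeSemigroup
  (CommutativeRing.+-commutativeSemigroup xor-∧-commutativeRing) using (interchange)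
open import Data.Nat using (ℕ; zero; suc; _+_; _*_; _^_; _∸_; _≤_; _≤ᵇ_; z≤n; s≤s)
open import Data.Nat.Properties
  using (≤-refl; ≤-trans; ≤-reflexive; ≤-antisym; ≤-pred; +-suc; +-comm; +-identityʳ; +-mono-≤;
         +-cancelˡ-≤; m+n∸m≡n; module ≤-Reasoning)
open import Data.Fin using (Fin; toℕ)
open import Data.List using (List; []; _∷_; _++_; map; concatMap; foldr; length; filterᵇ; allFin)
open import Data.Bool.ListAction using (any)
open import Data.List.Properties using (length-++; length-map; filter-all; filter-notAll)
open import Data.List.Relation.Unary.Any using (here; there; any?)
open import Data.List.Relation.Unary.Any.Properties using (any⁺; any⁻)
open import Data.List.Relation.Unary.All as All using ([])
open import Data.List.Relation.Unary.Unique.Propositional using (Unique)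
open import Data.List.Relation.Unary.AllPairs using ([]; _∷_)
open import Data.List.Relation.Unary.Unique.Propositional.Properties
  using () renaming (map⁺ to unique-map⁺; ++⁺ to unique-++⁺; filter⁺ to unique-filter⁺)
open import Data.List.Relation.Binary.Disjoint.Propositional using (Disjoint)
open import Data.List.Membership.Propositional using (find; lose) renaming (_∈_ to _∈ₗ_)
open import Data.List.Membership.Propositional.Properties
  using (∈-map⁺; ∈-map⁻; ∈-++⁺ˡ; ∈-++⁺ʳ; ∈-++⁻; ∈-filter⁺; ∈-filter⁻)
open import Data.Vec using ([]; _∷_; lookup)
open import Data.Vec.Properties
  using (zipWith-comm; zipWith-assoc; zipWith-identityˡ; zipWith-identityʳ; lookup-zipWith;
         ∷-injectiveˡ; ∷-injectiveʳ)
open import Data.Product using (∃; _×_; _,_; proj₁; proj₂)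
open import Data.Sum using (_⊎_; inj₁; inj₂)
open import Data.Empty using (⊥; ⊥-elim)
open import Function using (_∘_; Equivalence)
open import Relation.Nullary using (yes; no)
open import Relation.Binary.PropositionalEquality
  using (_≡_; _≢_; refl; sym; trans; cong; cong₂; subst; module ≡-Reasoning)

true≢false : true ≢ false
true≢false ()

xor-interchange : ∀ a b c d → (a xor b) xor (c xor d) ≡ (a xor c) xor (b xor d)
xor-interchange = interchange

∧-polar : ∀ p q r s → ((p xor r) ∧ (q xor s)) xor ((p ∧ q) xor (r ∧ s)) ≡ (p ∧ s) xor (r ∧ q)
∧-polar false false false false = refl
∧-polar false false false true  = refl
∧-polar false false true  false = refl
∧-polar false false true  true  = refl
∧-polar false true  false false = refl
∧-polar false true  false true  = refl
∧-polar false true  true  false = refl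
∧-polar false true  true  true  = refl
∧-polar true  false false false = refl
∧-polar true  false false true  = refl
∧-polar true  false true  false = refl
∧-polar true  false true  true  = refl
∧-polar true  true  false false = refl
∧-polar true  true  false true  = refl
∧-polar true  true  true  false = refl
∧-polar true  true  true  true  = refl

∧-intro : ∀ {x y} → x ≡ true → y ≡ true → x ∧ y ≡ true
∧-intro = cong₂ _∧_

∧-elim : ∀ {x y} → x ∧ y ≡ true → x ≡ true × y ≡ true
∧-elim {true} {true} _ = refl , refl

∖-intro : ∀ {x y} → x ≡ true → y ≡ false → x ∧ not y ≡ true
∖-intro = cong₂ (λ x y → x ∧ not y)

not-elim : ∀ {x} → not x ≡ true → x ≡ false
not-elim {false} _ = refl

not∧not-intro : ∀ {x y} → x ≡ false → y ≡ false → not x ∧ not y ≡ true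
not∧not-intro = cong₂ (λ x y → not x ∧ not y)

not∧not-elim : ∀ {x y} → not x ∧ not y ≡ true → x ≡ false × y ≡ false
not∧not-elim {false} {false} _ = refl , refl

not∨not-elim : ∀ {x y} → not x ∨ not y ≡ true → x ≡ true → y ≡ false
not∨not-elim {true} {false} _ _ = refl

xorSum-++ : ∀ xs ys → xorSum (xs ++ ys) ≡ xorSum xs xor xorSum ys
xorSum-++ []       ys = refl
xorSum-++ (x ∷ xs) ys = trans (cong (x xor_) (xorSum-++ xs ys)) (sym (xor-assoc x (xorSum xs) (xorSum ys)))

xorSum-concatMap : ∀ {A : Set} (f : A → List Bool) l →
                   xorSum (concatMap f l) ≡ xorSum (map (λ i → xorSum (f i)) l)
xorSum-concatMap f []      = refl
xorSum-concatMap f (i ∷ l) =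
  trans (xorSum-++ (f i) (concatMap f l)) (cong (xorSum (f i) xor_) (xorSum-concatMap f l))

⊕-self : ∀ {n} (x : F2 n) → x ⊕ x ≡ 0v
⊕-self []      = refl
⊕-self (b ∷ x) = cong₂ _∷_ (xor-same b) (⊕-self x)

module _ {n : ℕ} where

  ⊕-comm : (x y : F2 n) → x ⊕ y ≡ y ⊕ x
  ⊕-comm = zipWith-comm xor-comm

  ⊕-assoc : (x y z : F2 n) → (x ⊕ y) ⊕ z ≡ x ⊕ (y ⊕ z)
  ⊕-assoc = zipWith-assoc xor-assoc

  ⊕-cancelʳ : (x y : F2 n) → (x ⊕ y) ⊕ y ≡ x
  ⊕-cancelʳ x y = begin
    (x ⊕ y) ⊕ y  ≡⟨ ⊕-assoc x y y ⟩
    x ⊕ (y ⊕ y)  ≡⟨ cong (x ⊕_) (⊕-self y) ⟩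
    x ⊕ 0v       ≡⟨ zipWith-identityʳ {n = n} xor-identityʳ x ⟩
    x            ∎
    where open ≡-Reasoning

  ⊕-cancelˡ : (x y : F2 n) → x ⊕ (x ⊕ y) ≡ y
  ⊕-cancelˡ x y = begin
    x ⊕ (x ⊕ y)  ≡⟨ ⊕-assoc x x y ⟨
    (x ⊕ x) ⊕ y  ≡⟨ cong (_⊕ y) (⊕-self x) ⟩
    0v ⊕ y       ≡⟨ zipWith-identityˡ {n = n} xor-identityˡ y ⟩
    y            ∎
    where open ≡-Reasoning

  ⊕-injectiveʳ : ∀ (c : F2 n) {x y} → c ⊕ x ≡ c ⊕ y → x ≡ y
  ⊕-injectiveʳ c {x} {y} e = trans (sym (⊕-cancelˡ c x)) (trans (cong (c ⊕_) e) (⊕-cancelˡ c y))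

  ⊕-cancel-common : (x y v : F2 n) → (x ⊕ v) ⊕ (y ⊕ v) ≡ x ⊕ y
  ⊕-cancel-common x y v = begin
    (x ⊕ v) ⊕ (y ⊕ v)  ≡⟨ cong ((x ⊕ v) ⊕_) (⊕-comm y v) ⟩
    (x ⊕ v) ⊕ (v ⊕ y)  ≡⟨ ⊕-assoc (x ⊕ v) v y ⟨
    ((x ⊕ v) ⊕ v) ⊕ y  ≡⟨ cong (_⊕ y) (⊕-cancelʳ x v) ⟩
    x ⊕ y              ∎
    where open ≡-Reasoning

module _ {n : ℕ} where

  Additive : (F2 n → Bool) → Set
  Additive f = ∀ x y → f (x ⊕ y) ≡ f x xor f y

  additive-zero : ∀ {f} → Additive f → f 0v ≡ false
  additive-zero {f} F = begin
    f 0v              ≡⟨ cong f (⊕-self 0v) ⟨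
    f (0v ⊕ 0v)       ≡⟨ F 0v 0v ⟩
    f 0v xor f 0v     ≡⟨ xor-same (f 0v) ⟩
    false             ∎
    where open ≡-Reasoning

  additive-resp : ∀ {f g} → (∀ x → f x ≡ g x) → Additive g → Additive f
  additive-resp f≗g G x y =
    trans (f≗g _) (trans (G x y) (sym (cong₂ _xor_ (f≗g x) (f≗g y))))

  additive-xor : ∀ {f g} → Additive f → Additive g → Additive (λ x → f x xor g x)
  additive-xor {f} {g} F G x y =
    trans (cong₂ _xor_ (F x y) (G x y)) (xor-interchange (f x) (f y) (g x) (g y))

  additive-∧ʳ : ∀ {f} c → Additive f → Additive (λ x → f x ∧ c)
  additive-∧ʳ {f} c F x y = trans (cong (_∧ c) (F x y)) (∧-distribʳ-xor c (f x) (f y))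

  additive-∧ˡ : ∀ {f} c → Additive f → Additive (λ x → c ∧ f x)
  additive-∧ˡ {f} c F x y = trans (cong (c ∧_) (F x y)) (∧-distribˡ-xor c (f x) (f y))

  lookup-additive : ∀ i → Additive (λ x → lookup x i)
  lookup-additive i x y = lookup-zipWith _xor_ i x y

  polar : (F2 n → Bool) → F2 n → F2 n → Bool
  polar q x z = q (x ⊕ z) xor (q x xor q z)

  polar-sym : ∀ q x z → polar q x z ≡ polar q z x
  polar-sym q x z = cong₂ _xor_ (cong q (⊕-comm x z)) (xor-comm (q x) (q z))

  value-⊕ : ∀ q x z → q (x ⊕ z) ≡ polar q x z xor (q x xor q z)
  value-⊕ q x z = sym (begin
    (q (x ⊕ z) xor s) xor s  ≡⟨ xor-assoc (q (x ⊕ z)) s s ⟩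
    q (x ⊕ z) xor (s xor s)  ≡⟨ cong (q (x ⊕ z) xor_) (xor-same s) ⟩
    q (x ⊕ z) xor false      ≡⟨ xor-identityʳ _ ⟩
    q (x ⊕ z)                ∎)
    where
      open ≡-Reasoning
      s : Bool
      s = q x xor q z

  -- q is quadratic when its polar form is additive in the first argument
  -- (hence bilinear, by symmetry).
  IsQuadratic : (F2 n → Bool) → Set
  IsQuadratic q = ∀ z → Additive (λ x → polar q x z)

  quadratic-resp : ∀ {q r} → (∀ v → q v ≡ r v) → IsQuadratic r → IsQuadratic q
  quadratic-resp q≗r R z =
    additive-resp (λ x → cong₂ _xor_ (q≗r _) (cong₂ _xor_ (q≗r x) (q≗r z))) (R z)

  quadratic-zero : IsQuadratic (λ _ → false)
  quadratic-zero _ _ _ = refl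

  quadratic-xor : ∀ {q r} → IsQuadratic q → IsQuadratic r → IsQuadratic (λ v → q v xor r v)
  quadratic-xor {q} {r} Q R z =
    additive-resp polar-xor (additive-xor {f = λ x → polar q x z} {g = λ x → polar r x z} (Q z) (R z))
    where
      polar-xor : ∀ x → polar (λ v → q v xor r v) x z ≡ polar q x z xor polar r x z
      polar-xor x = trans (cong ((q (x ⊕ z) xor r (x ⊕ z)) xor_) (xor-interchange (q x) (r x) (q z) (r z)))
                          (xor-interchange (q (x ⊕ z)) (r (x ⊕ z)) (q x xor q z) (r x xor r z))

  quadratic-xorSum : ∀ {A : Set} (t : A → F2 n → Bool) → (∀ i → IsQuadratic (t i)) →
                     ∀ l → IsQuadratic (λ v → xorSum (map (λ i → t i v) l))
  quadratic-xorSum t Qt []      = quadratic-zero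
  quadratic-xorSum t Qt (i ∷ l) =
    quadratic-xor {q = t i} {r = λ v → xorSum (map (λ j → t j v) l)} (Qt i) (quadratic-xorSum t Qt l)

  quadratic-∧ˡ : ∀ {q} c → IsQuadratic q → IsQuadratic (λ v → c ∧ q v)
  quadratic-∧ˡ true  Q = Q
  quadratic-∧ˡ false _ = quadratic-zero

  quadratic-if : ∀ {q} b → IsQuadratic q → IsQuadratic (λ v → if b then q v else false)
  quadratic-if true  Q = Q
  quadratic-if false _ = quadratic-zero

  quadratic-product : ∀ {ℓ m} → Additive ℓ → Additive m → IsQuadratic (λ v → ℓ v ∧ m v)
  quadratic-product {ℓ} {m} L M z =
    additive-resp polar-product (additive-xor {f = λ x → ℓ x ∧ m z} {g = λ x → ℓ z ∧ m x}
      (additive-∧ʳ {f = ℓ} (m z) L) (additive-∧ˡ {f = m} (ℓ z) M))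
    where
      polar-product : ∀ x → polar (λ v → ℓ v ∧ m v) x z ≡ (ℓ x ∧ m z) xor (ℓ z ∧ m x)
      polar-product x =
        trans (cong (_xor ((ℓ x ∧ m x) xor (ℓ z ∧ m z))) (cong₂ _∧_ (L x z) (M x z)))
              (∧-polar (ℓ x) (m x) (ℓ z) (m z))

module _ {n : ℕ} (a : Coeffs n) where

  -- evalQ a is a sum of monomials a_ij u_i u_j, each quadratic.
  evalQ-quadratic : IsQuadratic (evalQ a)
  evalQ-quadratic =
    quadratic-resp (λ u → xorSum-concatMap (λ i → map (λ j → term i j u) (allFin n)) (allFin n))
      (quadratic-xorSum (λ i u → xorSum (map (λ j → term i j u) (allFin n)))
                        (λ i → quadratic-xorSum (term i) (term-quadratic i) (allFin n)) (allFin n))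
    where
      term : Fin n → Fin n → F2 n → Bool
      term i j u = if toℕ i ≤ᵇ toℕ j then a i j ∧ (lookup u i ∧ lookup u j) else false

      term-quadratic : ∀ i j → IsQuadratic (term i j)
      term-quadratic i j = quadratic-if (toℕ i ≤ᵇ toℕ j)
        (quadratic-∧ˡ (a i j) (quadratic-product {ℓ = λ u → lookup u i} {m = λ u → lookup u j}
          (lookup-additive i) (lookup-additive j)))

  bilin-sym : ∀ x y → bilin a x y ≡ bilin a y x
  bilin-sym = polar-sym (evalQ a)

  bilin-additiveˡ : ∀ z → Additive (λ x → bilin a x z)
  bilin-additiveˡ = evalQ-quadratic

  bilin-additiveʳ : ∀ u → Additive (bilin a u)
  bilin-additiveʳ u = additive-resp (bilin-sym u) (bilin-additiveˡ u)

  evalQ-⊕ : ∀ x y → evalQ a (x ⊕ y) ≡ bilin a x y xor (evalQ a x xor evalQ a y)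
  evalQ-⊕ = value-⊕ (evalQ a)

∈-filterᵇ⁺ : ∀ {A : Set} (p : A → Bool) {x xs} → x ∈ₗ xs → p x ≡ true → x ∈ₗ filterᵇ p xs
∈-filterᵇ⁺ p x∈ px = ∈-filter⁺ (T? ∘ p) x∈ (Equivalence.from T-≡ px)

∈-filterᵇ⁻ : ∀ {A : Set} (p : A → Bool) {x xs} → x ∈ₗ filterᵇ p xs → x ∈ₗ xs × p x ≡ true
∈-filterᵇ⁻ p x∈ with x∈xs , px ← ∈-filter⁻ (T? ∘ p) x∈ = x∈xs , Equivalence.to T-≡ px

unique-filterᵇ : ∀ {A : Set} (p : A → Bool) {xs} → Unique xs → Unique (filterᵇ p xs)
unique-filterᵇ p = unique-filter⁺ (T? ∘ p)

any-intro : ∀ {A : Set} (p : A → Bool) {x xs} → x ∈ₗ xs → p x ≡ true → any p xs ≡ true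
any-intro p x∈ px = Equivalence.to T-≡ (any⁺ p (lose x∈ (Equivalence.from T-≡ px)))

any-elim : ∀ {A : Set} (p : A → Bool) xs → any p xs ≡ true → ∃ λ x → x ∈ₗ xs × p x ≡ true
any-elim p xs e with x , x∈ , px ← find (any⁻ p xs (Equivalence.from T-≡ e)) =
  x , x∈ , Equivalence.to T-≡ px

any-false : ∀ {A : Set} (p : A → Bool) xs → (∀ {x} → x ∈ₗ xs → p x ≡ false) → any p xs ≡ false
any-false p xs none = ¬-not λ e →
  let x , x∈ , px = any-elim p xs e in true≢false (trans (sym px) (none x∈))

allB-∈ : ∀ {A : Set} (p : A → Bool) xs {x} → allB p xs ≡ true → x ∈ₗ xs → p x ≡ true
allB-∈ p (y ∷ xs) all (here refl) = proj₁ (∧-elim all)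
allB-∈ p (y ∷ xs) all (there x∈)  = allB-∈ p xs (proj₂ (∧-elim all)) x∈

length-filterᵇ-split : ∀ {A : Set} (p r : A → Bool) xs →
  length (filterᵇ p xs) ≡
  length (filterᵇ (λ v → p v ∧ r v) xs) + length (filterᵇ (λ v → p v ∧ not (r v)) xs)
length-filterᵇ-split p r [] = refl
length-filterᵇ-split p r (x ∷ xs) with p x | r x
... | true  | true  = cong suc (length-filterᵇ-split p r xs)
... | true  | false = trans (cong suc (length-filterᵇ-split p r xs)) (sym (+-suc _ _))
... | false | _     = length-filterᵇ-split p r xs

length-partition : ∀ {A : Set} (p : A → Bool) xs →
  length xs ≡ length (filterᵇ p xs) + length (filterᵇ (not ∘ p) xs)
length-partition p xs =
  trans (cong length (sym (filter-all (T? ∘ λ _ → true) (All.universal _ xs))))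
        (length-filterᵇ-split (λ _ → true) p xs)

∈-remove : ∀ {A : Set} {x : A} {ys} → x ∈ₗ ys →
  ∃ λ ys' → length ys ≡ suc (length ys') × (∀ {y} → y ∈ₗ ys → y ≢ x → y ∈ₗ ys')
∈-remove {ys = _ ∷ ys} (here refl) =
  ys , refl , λ { (here refl) y≢x → ⊥-elim (y≢x refl) ; (there y∈) _ → y∈ }
∈-remove {ys = z ∷ ys} (there x∈) with ys' , len , keep ← ∈-remove x∈ =
  z ∷ ys' , cong suc len , λ { (here refl) _ → here refl ; (there y∈) y≢x → there (keep y∈ y≢x) }

unique-⊆-length : ∀ {A : Set} {xs ys : List A} → Unique xs → (∀ {x} → x ∈ₗ xs → x ∈ₗ ys) →
                  length xs ≤ length ys
unique-⊆-length {xs = []}     _               _     = z≤n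
unique-⊆-length {xs = x ∷ xs} (x∉xs ∷ xs-uniq) xs⊆ys with ys' , len , keep ← ∈-remove (xs⊆ys (here refl))
  rewrite len = s≤s (unique-⊆-length xs-uniq λ y∈ →
    keep (xs⊆ys (there y∈)) (λ y≡x → All.lookup x∉xs y∈ (sym y≡x)))

allVecs-complete : ∀ n (v : F2 n) → v ∈ₗ allVecs n
allVecs-complete zero    []      = here refl
allVecs-complete (suc n) (true  ∷ v) = ∈-++⁺ˡ (∈-map⁺ (true ∷_) (allVecs-complete n v))
allVecs-complete (suc n) (false ∷ v) =
  ∈-++⁺ʳ (map (true ∷_) (allVecs n)) (∈-map⁺ (false ∷_) (allVecs-complete n v))

allVecs-unique : ∀ n → Unique (allVecs n)
allVecs-unique zero    = [] ∷ []
allVecs-unique (suc n) =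
  unique-++⁺ (unique-map⁺ ∷-injectiveʳ (allVecs-unique n)) (unique-map⁺ ∷-injectiveʳ (allVecs-unique n))
    heads-differ
  where
    heads-differ : Disjoint (map (true ∷_) (allVecs n)) (map (false ∷_) (allVecs n))
    heads-differ (t∈ , f∈)
      with _ , _ , refl ← ∈-map⁻ (true ∷_) t∈ with _ , _ , e ← ∈-map⁻ (false ∷_) f∈ =
      true≢false (∷-injectiveˡ e)

allVecs-length : ∀ n → length (allVecs n) ≡ 2 ^ n
allVecs-length zero    = refl
allVecs-length (suc n) = begin
  length (map (true ∷_) (allVecs n) ++ map (false ∷_) (allVecs n))
    ≡⟨ length-++ (map (true ∷_) (allVecs n)) ⟩
  length (map (true ∷_) (allVecs n)) + length (map (false ∷_) (allVecs n))
    ≡⟨ cong₂ _+_ (length-map (true ∷_) (allVecs n)) (length-map (false ∷_) (allVecs n)) ⟩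
  length (allVecs n) + length (allVecs n)
    ≡⟨ cong₂ _+_ (allVecs-length n) (trans (allVecs-length n) (sym (+-identityʳ (2 ^ n)))) ⟩
  2 ^ suc n ∎
  where open ≡-Reasoning

module _ {n : ℕ} where

  _∖_ : Subset n → Subset n → Subset n
  (P ∖ R) v = P v ∧ not (R v)

  unique-≤-card : ∀ {P : Subset n} {xs} → Unique xs → (∀ {x} → x ∈ₗ xs → x ∈ P) → length xs ≤ card P
  unique-≤-card {P} xs-uniq xs⊆P =
    unique-⊆-length xs-uniq λ x∈ → ∈-filterᵇ⁺ P (allVecs-complete n _) (xs⊆P x∈)

  card-mono : ∀ {P R : Subset n} → (∀ {v} → v ∈ P → v ∈ R) → card P ≤ card R
  card-mono {P} P⊆R = unique-≤-card (unique-filterᵇ P (allVecs-unique n)) λ v∈ →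
    P⊆R (proj₂ (∈-filterᵇ⁻ P {xs = allVecs n} v∈))

  card-split : ∀ (P R : Subset n) → card P ≡ card (P ∩ R) + card (P ∖ R)
  card-split P R = length-filterᵇ-split P R (allVecs n)

  card-∖ : ∀ {P R : Subset n} → (∀ {v} → v ∈ P → v ∈ R) → card (R ∖ P) ≡ card R ∸ card P
  card-∖ {P} {R} P⊆R = begin
    card (R ∖ P)                         ≡⟨ m+n∸m≡n (card P) (card (R ∖ P)) ⟨
    card P + card (R ∖ P) ∸ card P        ≡⟨ cong (λ k → k + card (R ∖ P) ∸ k) card-P ⟩
    card (R ∩ P) + card (R ∖ P) ∸ card (R ∩ P) ≡⟨ cong (_∸ card (R ∩ P)) (card-split R P) ⟨
    card R ∸ card (R ∩ P)                 ≡⟨ cong (card R ∸_) card-P ⟨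
    card R ∸ card P                       ∎
    where
      open ≡-Reasoning
      card-P : card P ≡ card (R ∩ P)
      card-P = ≤-antisym (card-mono λ p → ∧-intro (P⊆R p) p) (card-mono λ rp → proj₂ (∧-elim rp))

IndexAtMostTwo : ∀ {n} → Subset n → Set
IndexAtMostTwo {n} H = ∀ (x y : F2 n) → H x ≡ false → H y ≡ false → (x ⊕ y) ∈ H

module _ {n : ℕ} {H : Subset n} (H-sub : IsSubspace H) where

  translate-outside : ∀ {x d} → H x ≡ false → d ∈ H → H (x ⊕ d) ≡ false
  translate-outside {x} {d} Hx Hd with H (x ⊕ d) in Hxd
  ... | false = refl
  ... | true  = ⊥-elim (true≢false (trans (sym x∈H) Hx))
    where
      x∈H : x ∈ H
      x∈H = subst (_∈ H) (⊕-cancelʳ x d) (proj₂ H-sub _ _ Hxd Hd)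

  private
    hs : List (F2 n)
    hs = filterᵇ H (allVecs n)

    ∈-translate : ∀ {c v} → v ∈ₗ map (c ⊕_) hs → (c ⊕ v) ∈ H
    ∈-translate {c} v∈ with h , h∈ , refl ← ∈-map⁻ (c ⊕_) v∈ =
      subst (_∈ H) (sym (⊕-cancelˡ c h)) (proj₂ (∈-filterᵇ⁻ H {xs = allVecs n} h∈))

    translate-disjoint : ∀ {x} → H x ≡ false → Disjoint hs (map (x ⊕_) hs)
    translate-disjoint Hx (v∈H , v∈xH) =
      true≢false (trans (sym (∈-translate v∈xH))
        (translate-outside Hx (proj₂ (∈-filterᵇ⁻ H {xs = allVecs n} v∈H))))

  -- If 2|H| = 2ⁿ and x, y, x + y ∉ H, then H, x + H, y + H are disjoint,
  -- giving 3|H| ≤ 2ⁿ = 2|H| although 0 ∈ H.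
  index-two : 2 * card H ≡ 2 ^ n → IndexAtMostTwo H
  index-two cardH x y Hx Hy with H (x ⊕ y) in Hxy
  ... | true  = refl
  ... | false = ⊥-elim (three-le-two 1≤c (begin
        c + (c + c)         ≡⟨ L-length ⟨
        length L            ≤⟨ unique-⊆-length L-unique (λ _ → allVecs-complete n _) ⟩
        length (allVecs n)  ≡⟨ allVecs-length n ⟩
        2 ^ n               ≡⟨ cardH ⟨
        2 * c               ∎))
    where
      open ≤-Reasoning
      c : ℕ
      c = card H
      L : List (F2 n)
      L = hs ++ (map (x ⊕_) hs ++ map (y ⊕_) hs)

      1≤c : 1 ≤ c
      1≤c = unique-≤-card {P = H} ([] ∷ []) λ { (here refl) → proj₁ H-sub }

      L-length : length L ≡ c + (c + c)
      L-length = trans (length-++ hs) (cong (c +_)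
        (trans (length-++ (map (x ⊕_) hs)) (cong₂ _+_ (length-map (x ⊕_) hs) (length-map (y ⊕_) hs))))

      translates-disjoint : Disjoint (map (x ⊕_) hs) (map (y ⊕_) hs)
      translates-disjoint {v} (v∈xH , v∈yH) = true≢false (trans (sym (subst (_∈ H) (⊕-cancel-common x y v)
        (proj₂ H-sub _ _ (∈-translate v∈xH) (∈-translate v∈yH)))) Hxy)

      H-disjoint : Disjoint hs (map (x ⊕_) hs ++ map (y ⊕_) hs)
      H-disjoint (v∈H , v∈) with ∈-++⁻ (map (x ⊕_) hs) v∈
      ... | inj₁ v∈xH = translate-disjoint Hx (v∈H , v∈xH)
      ... | inj₂ v∈yH = translate-disjoint Hy (v∈H , v∈yH)

      hs-unique : Unique hs
      hs-unique = unique-filterᵇ H (allVecs-unique n)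

      L-unique : Unique L
      L-unique = unique-++⁺ hs-unique (unique-++⁺ (unique-map⁺ (⊕-injectiveʳ x) hs-unique)
                   (unique-map⁺ (⊕-injectiveʳ y) hs-unique) translates-disjoint) H-disjoint

      three-le-two : 1 ≤ c → c + (c + c) ≤ 2 * c → ⊥
      three-le-two 1≤c le with ≤-trans 1≤c (+-cancelˡ-≤ c _ _ (+-cancelˡ-≤ c _ _ le))
      ... | ()

additive-witness : ∀ {n} {f : F2 n → Bool} → Additive f → ∀ ls → f (foldr _⊕_ 0v ls) ≡ true →
                   ∃ λ s → s ∈ₗ ls × f s ≡ true
additive-witness {f = f} F [] f0 = ⊥-elim (true≢false (trans (sym f0) (additive-zero {f = f} F)))
additive-witness {f = f} F (s ∷ ls) fsum with f s in fs
... | true  = s , here refl , fs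
... | false with σ , σ∈ , fσ ← additive-witness F ls
                  (trans (cong (_xor f (foldr _⊕_ 0v ls)) (sym fs)) (trans (sym (F s _)) fsum)) =
  σ , there σ∈ , fσ

vanishing-or-witness : ∀ {n} (f : F2 n → Bool) → (∀ w → f w ≡ false) ⊎ ∃ λ w → f w ≡ true
vanishing-or-witness {n} f with any? (λ w → f w ≟ true) (allVecs n)
... | yes found = inj₂ (let w , _ , fw = find found in w , fw)
... | no  none  = inj₁ λ w → ¬-not λ fw → none (lose (allVecs-complete n w) fw)

partner-of-nonradical : ∀ {n} (a : Coeffs n) {S : Subset n} {u} → Generates S → (InRad a u → ⊥) →
                        ∃ λ σ → σ ∈ S × bilin a σ u ≡ true
partner-of-nonradical a {u = u} gen ¬rad with vanishing-or-witness (bilin a u)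
... | inj₁ rad = ⊥-elim (¬rad rad)
... | inj₂ (w , Buw) with ls , ls⊆S , Σls≡w ← gen w
  with σ , σ∈ls , Buσ ← additive-witness (bilin-additiveʳ a u) ls (trans (cong (bilin a u) Σls≡w) Buw) =
  σ , All.lookup ls⊆S σ∈ls , trans (bilin-sym a σ u) Buσ

perp-orthogonal : ∀ {n} (a : Coeffs n) {T v t} → v ∈ perp a T → t ∈ T → bilin a v t ≡ false
perp-orthogonal {n} a {t = t} v∈perp t∈T =
  not∨not-elim (allB-∈ _ (allVecs n) v∈perp (allVecs-complete n t)) t∈T

module Counting {n : ℕ} (a : Coeffs n) (H : Subset n)
                (H-sub : IsSubspace H) (H-index : IndexAtMostTwo H) where

  S : Subset n
  S = Sset a H

  ∈S-elim : ∀ {v} → v ∈ S → evalQ a v ≡ false × H v ≡ false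
  ∈S-elim = not∧not-elim

  shift-in-S : ∀ {σ u₀ u} → σ ∈ S → u₀ ∈ S → u ∈ S →
               bilin a σ u₀ ≡ true → bilin a σ u ≡ true → bilin a u₀ u ≡ false → (σ ⊕ (u₀ ⊕ u)) ∈ S
  shift-in-S {σ} {u₀} {u} σ∈S u₀∈S u∈S Bσu₀ Bσu Bu₀u
    with Qσ , Hσ ← ∈S-elim σ∈S with Qu₀ , Hu₀ ← ∈S-elim u₀∈S with Qu , Hu ← ∈S-elim u∈S =
    not∧not-intro Q-shift (translate-outside H-sub Hσ (H-index u₀ u Hu₀ Hu))
    where
      Q-diff : evalQ a (u₀ ⊕ u) ≡ false
      Q-diff = trans (evalQ-⊕ a u₀ u) (cong₂ _xor_ Bu₀u (cong₂ _xor_ Qu₀ Qu))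
      B-diff : bilin a σ (u₀ ⊕ u) ≡ false
      B-diff = trans (bilin-additiveʳ a σ u₀ u) (cong₂ _xor_ Bσu₀ Bσu)
      Q-shift : evalQ a (σ ⊕ (u₀ ⊕ u)) ≡ false
      Q-shift = trans (evalQ-⊕ a σ (u₀ ⊕ u)) (cong₂ _xor_ B-diff (cong₂ _xor_ Qσ Q-diff))

  shift-pairing : ∀ σ u₀ u x →
                  bilin a (σ ⊕ (u₀ ⊕ u)) x ≡ bilin a σ x xor (bilin a u₀ x xor bilin a u x)
  shift-pairing σ u₀ u x =
    trans (bilin-additiveˡ a x σ (u₀ ⊕ u)) (cong (bilin a σ x xor_) (bilin-additiveˡ a x u₀ u))

  record Admissible (U : List (F2 n)) : Set where
    field
      distinct  : Unique U
      inS       : ∀ {u} → u ∈ₗ U → u ∈ S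
      isotropic : ∀ {u u'} → u ∈ₗ U → u' ∈ₗ U → bilin a u u' ≡ false
      partner   : ∀ {u} → u ∈ₗ U → ∃ λ σ → σ ∈ S × bilin a σ u ≡ true

  admissible-filter : ∀ p {U} → Admissible U → Admissible (filterᵇ p U)
  admissible-filter p adm = record
    { distinct  = unique-filterᵇ p distinct
    ; inS       = λ u∈ → inS (⊆U u∈)
    ; isotropic = λ u∈ u'∈ → isotropic (⊆U u∈) (⊆U u'∈)
    ; partner   = λ u∈ → partner (⊆U u∈)
    }
    where
      open Admissible adm
      ⊆U : ∀ {u U} → u ∈ₗ filterᵇ p U → u ∈ₗ U
      ⊆U u∈ = proj₁ (∈-filterᵇ⁻ p u∈)

  Partners : List (F2 n) → Subset n
  Partners U s = S s ∧ any (bilin a s) U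

  partners-mono : ∀ {U₀ U} → (∀ {x} → x ∈ₗ U₀ → x ∈ₗ U) → ∀ {v} → v ∈ Partners U₀ → v ∈ Partners U
  partners-mono {U₀} U₀⊆U {v} v∈
    with v∈S , pairs ← ∧-elim v∈ with x , x∈ , Bvx ← any-elim (bilin a v) U₀ pairs =
    ∧-intro v∈S (any-intro (bilin a v) (U₀⊆U x∈) Bvx)

  shift-lands : ∀ {u₀ U' σ} → Admissible (u₀ ∷ U') → σ ∈ S → bilin a σ u₀ ≡ true →
                ∀ {u} → u ∈ₗ filterᵇ (bilin a σ) (u₀ ∷ U') →
                (σ ⊕ (u₀ ⊕ u)) ∈ (Partners (u₀ ∷ U') ∖ Partners (filterᵇ (not ∘ bilin a σ) (u₀ ∷ U')))
  shift-lands {u₀} {U'} {σ} adm σ∈S Bσu₀ {u} u∈U₁ with u∈U , Bσu ← ∈-filterᵇ⁻ (bilin a σ) u∈U₁ =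
    ∖-intro (∧-intro shift∈S (any-intro (bilin a φ) {xs = u₀ ∷ U'} (here refl) pairs-u₀))
            (trans (cong (S φ ∧_) (any-false (bilin a φ) _ unpaired-U₀)) (∧-zeroʳ (S φ)))
    where
      open Admissible adm
      φ : F2 n
      φ = σ ⊕ (u₀ ⊕ u)
      shift∈S : φ ∈ S
      shift∈S = shift-in-S σ∈S (inS (here refl)) (inS u∈U) Bσu₀ Bσu (isotropic (here refl) u∈U)
      pairs-u₀ : bilin a φ u₀ ≡ true
      pairs-u₀ = trans (shift-pairing σ u₀ u u₀)
        (cong₂ _xor_ Bσu₀ (cong₂ _xor_ (isotropic (here refl) (here refl)) (isotropic u∈U (here refl))))
      unpaired-U₀ : ∀ {x} → x ∈ₗ filterᵇ (not ∘ bilin a σ) (u₀ ∷ U') → bilin a φ x ≡ false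
      unpaired-U₀ x∈ with x∈U , nBσx ← ∈-filterᵇ⁻ (not ∘ bilin a σ) x∈ = trans (shift-pairing σ u₀ u _)
        (cong₂ _xor_ (not-elim nBσx)
                     (cong₂ _xor_ (isotropic (here refl) x∈U) (isotropic u∈U x∈U)))

  partners-bound : ∀ k {U} → length U ≤ k → Admissible U → length U ≤ card (Partners U)
  partners-bound _       {[]}      _   _   = z≤n
  partners-bound (suc k) {u₀ ∷ U'} len adm
    with σ , σ∈S , Bσu₀ ← Admissible.partner adm (here refl) = begin
    length U                     ≡⟨ length-partition (bilin a σ) U ⟩
    length U₁ + length U₀        ≤⟨ +-mono-≤ U₁-bound U₀-bound ⟩
    card (P ∖ P₀) + card (P ∩ P₀) ≡⟨ +-comm (card (P ∖ P₀)) (card (P ∩ P₀)) ⟩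
    card (P ∩ P₀) + card (P ∖ P₀) ≡⟨ card-split P P₀ ⟨
    card P                       ∎
    where
      open ≤-Reasoning
      U U₁ U₀ : List (F2 n)
      U  = u₀ ∷ U'
      U₁ = filterᵇ (bilin a σ) U
      U₀ = filterᵇ (not ∘ bilin a σ) U
      P P₀ : Subset n
      P  = Partners U
      P₀ = Partners U₀

      U₀-shorter : length U₀ ≤ k
      U₀-shorter = ≤-pred (≤-trans
        (filter-notAll (T? ∘ (not ∘ bilin a σ)) U (here (subst (T ∘ not) Bσu₀))) len)

      U₀⊆U : ∀ {x} → x ∈ₗ U₀ → x ∈ₗ U
      U₀⊆U x∈ = proj₁ (∈-filterᵇ⁻ (not ∘ bilin a σ) x∈)

      U₀-bound : length U₀ ≤ card (P ∩ P₀)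
      U₀-bound = ≤-trans (partners-bound k U₀-shorter (admissible-filter (not ∘ bilin a σ) adm))
        (card-mono {P = P₀} {R = P ∩ P₀} λ {v} p → ∧-intro (partners-mono U₀⊆U {v} p) p)

      shift : F2 n → F2 n
      shift u = σ ⊕ (u₀ ⊕ u)

      shift-injective : ∀ {u v} → shift u ≡ shift v → u ≡ v
      shift-injective e = ⊕-injectiveʳ u₀ (⊕-injectiveʳ σ e)

      U₁-bound : length U₁ ≤ card (P ∖ P₀)
      U₁-bound = begin
        length U₁            ≡⟨ length-map shift U₁ ⟨
        length (map shift U₁) ≤⟨ unique-≤-card (unique-map⁺ shift-injective
                                  (unique-filterᵇ (bilin a σ) (Admissible.distinct adm))) image⊆ ⟩
        card (P ∖ P₀)        ∎
        where
          image⊆ : ∀ {v} → v ∈ₗ map shift U₁ → v ∈ (P ∖ P₀)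
          image⊆ v∈ with u , u∈U₁ , refl ← ∈-map⁻ shift v∈ = shift-lands adm σ∈S Bσu₀ u∈U₁

  perp-admissible : ∀ {T} → Generates S → (∀ v → v ∈ T → v ∈ S) →
                    (∀ r → r ∈ T → InRad a r → evalQ a r ≡ false → ⊥) →
                    Admissible (filterᵇ (perp a T ∩ T) (allVecs n))
  perp-admissible {T} gen T⊆S no-singular-rad = record
    { distinct  = unique-filterᵇ _ (allVecs-unique n)
    ; inS       = λ u∈ → T⊆S _ (in-T u∈)
    ; isotropic = λ {u} u∈ u'∈ → perp-orthogonal a {T} {u} (in-perp u∈) (in-T u'∈)
    ; partner   = λ {u} u∈ → partner-of-nonradical a gen λ rad →
                    no-singular-rad u (in-T u∈) rad (proj₁ (∈S-elim (T⊆S u (in-T u∈))))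
    }
    where
      in-perp : ∀ {u} → u ∈ₗ filterᵇ (perp a T ∩ T) (allVecs n) → u ∈ perp a T
      in-perp u∈ = proj₁ (∧-elim (proj₂ (∈-filterᵇ⁻ (perp a T ∩ T) {xs = allVecs n} u∈)))
      in-T : ∀ {u} → u ∈ₗ filterᵇ (perp a T ∩ T) (allVecs n) → u ∈ T
      in-T u∈ = proj₂ (∧-elim (proj₂ (∈-filterᵇ⁻ (perp a T ∩ T) {xs = allVecs n} u∈)))

  -- No element of T pairs nontrivially with an element of T^⊥.
  partners-outside : ∀ {T v} → v ∈ Partners (filterᵇ (perp a T ∩ T) (allVecs n)) → v ∈ (S ∖ T)
  partners-outside {T} {v} v∈
    with v∈S , pairs ← ∧-elim v∈ with x , x∈ , Bvx ← any-elim (bilin a v) _ pairs =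
    ∖-intro v∈S (¬-not λ v∈T → true≢false (trans (sym Bvx)
      (trans (bilin-sym a v x) (perp-orthogonal a {T} {x} x∈perp v∈T))))
    where
      x∈perp : x ∈ perp a T
      x∈perp = proj₁ (∧-elim (proj₂ (∈-filterᵇ⁻ (perp a T ∩ T) {xs = allVecs n} x∈)))

proposition3p5 : (n : ℕ) (a : Coeffs n) (H : Subset n)
    → IsSubspace H → 2 * card H ≡ 2 ^ n
    → Generates (Sset a H)
    → (T : Subset n)
    → (∀ v → v ∈ T → v ∈ Sset a H)
    → (∀ r → r ∈ T → InRad a r → evalQ a r ≡ false → ⊥)
    → card (perp a T ∩ T) ≤ card (Sset a H) ∸ card T
proposition3p5 n a H H-sub cardH gen T T⊆S no-singular-rad = begin
  card (perp a T ∩ T)  ≤⟨ partners-bound (length U) ≤-refl (perp-admissible gen T⊆S no-singular-rad) ⟩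
  card (Partners U)    ≤⟨ card-mono (λ {v} → partners-outside {T} {v}) ⟩
  card (S ∖ T)         ≡⟨ card-∖ (λ {v} → T⊆S v) ⟩
  card S ∸ card T      ∎
  where
    open ≤-Reasoning
    open Counting a H H-sub (index-two H-sub cardH)
    U : List (F2 n)
    U = filterᵇ (perp a T ∩ T) (allVecs n)
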